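{- Consider the concurrent open shop special case of the non-clairvoyant online weighted coflow scheduling problem described in the context (all demand matrices diagonal and all port capacities equal to $1$), with $p$ the maximum number of flows of any coflow. The rate allocation \[ r^{\mathrm{conc}}_{iik}(t) = \frac{w_k \mathbf{1}_{iik}^t}{\sum_{l\in Q_t} w_l \mathbf{1}_{iil}^t} \] (zero for $t<R_k$) is feasible, and the weighted sum of coflow completion times of the schedule it produces is at most $4p$ times the optimal weighted sum of coflow completion times $J_{\mathrm{OPT}}$.
   Context: An $m\times m$ switch has input ports and output ports $i=1,\dots,m$, all of capacity $1$. Time is slotted, $t=0,1,2,\dots$. There are $n$ coflows; coflow $k$ consists of a diagonal demand matrix $C_k=[d_{ijk}]$ (so $d_{ijk}=0$ for $i\neq j$) with nonnegative entries, a release time $R_k\ge 0$, and a weight $w_k>0$. Each nonzero entry $d_{iik}$ is a flow requiring $d_{iik}$ units of data to be sent from input port $i$ to output port $i$. A schedule assigns rates $x_{ijkt}\ge 0$, zero for $t<R_k$, with $\sum_{j,k}x_{ijkt}\le 1$ for all input ports $i$ and times $t$, and $\sum_{i,k}x_{ijkt}\le 1$ for all output ports $j$ and times $t$; a flow is finished once its cumulative rate reaches its demand. The completion time $T_k$ of coflow $k$ is the time by which all its flows are finished; the objective is $\sum_k w_kT_k$, and $J_{\mathrm{OPT}}$ is its minimum over all feasible schedules with full knowledge of demands and release times. In the non-clairvoyant online setting, at time $t$ the scheduler knows only, for released coflows $k\in Q_t=\{k:t\ge R_k\}$, their weights and indicators $\mathbf{1}^t_{iik}\in\{0,1\}$,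 equal to $1$ iff flow $(i,i)$ of coflow $k$ exists and is unfinished at time $t$. $p$ is the maximum over $k$ of the number of nonzero entries of $C_k$.
   Formalization: The demands $d_{iik}$, the weights $w_k$ and the rates of the schedules over which $J_{\mathrm{OPT}}$ is minimized are rational. -}

module Defs where

open import Data.Nat as ℕ using (ℕ; zero; suc)
open import Data.Integer using (+_)
open import Data.Fin using (Fin)
open import Data.List using (foldr; allFin)
open import Data.Bool using (Bool; true; false; if_then_else_; _∧_)
open import Data.Product using (Σ; _×_; _,_)
open import Relation.Nullary using (¬_; yes; no)
open import Relation.Nullary.Decidable using (⌊_⌋)
open import Relation.Binary.PropositionalEquality using (_≡_)
open import Data.Fin.Properties using () renaming (_≟_ to _≟F_)
open import Data.Rational using (ℚ; 0ℚ; _+_; _*_; _/_; _÷_; _≤_; _<_; ≢-nonZero)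
open import Data.Rational.Properties using (_≟_; _<?_)

ΣF : ∀ {k} → (Fin k → ℚ) → ℚ
ΣF {k} f = foldr (λ i acc → f i + acc) 0ℚ (allFin k)

Σ< : ℕ → (ℕ → ℚ) → ℚ
Σ< zero    f = 0ℚ
Σ< (suc T) f = Σ< T f + f T

ℕ→ℚ : ℕ → ℚ
ℕ→ℚ n = + n / 1

maxF : ∀ {k} → (Fin k → ℕ) → ℕ
maxF {k} f = foldr (λ i acc → f i ℕ.⊔ acc) 0 (allFin k)

countF : ∀ {k} → (Fin k → Bool) → ℕ
countF {k} f = foldr (λ i acc → if f i then suc acc else acc) 0 (allFin k)

-- Concurrent open shop instance: m ports, n coflows.
-- Coflow k has the diagonal demand matrix C_k with entries
-- d_{iik} = dem k i (off-diagonal entries are 0), release time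
-- rel k and weight wt k.

record Instance (m n : ℕ) : Set where
  field
    dem : Fin n → Fin m → ℚ
    rel : Fin n → ℕ
    wt  : Fin n → ℚ

WellFormed : ∀ {m n} → Instance m n → Set
WellFormed {m} {n} I =
  (∀ (k : Fin n) (i : Fin m) → 0ℚ ≤ Instance.dem I k i) ×
  (∀ (k : Fin n) → 0ℚ < Instance.wt I k)

demand : ∀ {m n} → Instance m n → Fin n → Fin m → Fin m → ℚ
demand I k i j with i ≟F j
... | yes _ = Instance.dem I k i
... | no  _ = 0ℚ

pmax : ∀ {m n} → Instance m n → ℕ
pmax I = maxF (λ k → countF (λ i → ⌊ Instance.dem I k i <? 0ℚ ⌋ Data.Bool.∨ ⌊ 0ℚ <? Instance.dem I k i ⌋))
  where import Data.Bool

-- Schedules: x k i j t is the rate x_{ijkt} of flow (i,j) of coflow k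
-- in time slot t.

Schedule : ℕ → ℕ → Set
Schedule m n = Fin n → Fin m → Fin m → ℕ → ℚ

Feasible : ∀ {m n} → Instance m n → Schedule m n → Set
Feasible {m} {n} I x =
  (∀ k i j t → 0ℚ ≤ x k i j t) ×
  (∀ k i j t → t ℕ.< Instance.rel I k → x k i j t ≡ 0ℚ) ×
  (∀ (i : Fin m) t → ΣF (λ j → ΣF (λ k → x k i j t)) ≤ 1ℚ) ×
  (∀ (j : Fin m) t → ΣF (λ i → ΣF (λ k → x k i j t)) ≤ 1ℚ)
  where open import Data.Rational using (1ℚ)

sent : ∀ {m n} → Schedule m n → Fin n → Fin m → Fin m → ℕ → ℚ
sent x k i j T = Σ< T (x k i j)

FinishedBy : ∀ {m n} → Instance m n → Schedule m n → Fin n → ℕ → Set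
FinishedBy {m} I x k T = ∀ (i j : Fin m) → demand I k i j ≤ sent x k i j T

IsCompletionTime : ∀ {m n} → Instance m n → Schedule m n → Fin n → ℕ → Set
IsCompletionTime I x k T =
  FinishedBy I x k T × (∀ T′ → T′ ℕ.< T → ¬ FinishedBy I x k T′)

cost : ∀ {m n} → Instance m n → (Fin n → ℕ) → ℚ
cost I T = ΣF (λ k → Instance.wt I k * ℕ→ℚ (T k))

-- The state is the cumulative amount sent on each
-- diagonal flow, computed slot by slot.

-- Division returning 0 when the denominator is 0 (only happens when
-- the numerator is 0 as well, as all indicator terms vanish).
_÷₀_ : ℚ → ℚ → ℚ
p ÷₀ q with q ≟ 0ℚ
... | yes _  = 0ℚ
... | no q≢0 = _÷_ p q {{≢-nonZero q≢0}}

module Conc {m n : ℕ} (I : Instance m n) where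
  open Instance I

  active : ℕ → Fin n → Fin m → ℚ → Bool
  active t k i c = ⌊ rel k ℕ.≤? t ⌋ ∧ (⌊ 0ℚ <? dem k i ⌋ Data.Bool.∨ ⌊ dem k i <? 0ℚ ⌋) ∧ ⌊ c <? dem k i ⌋
    where import Data.Bool

  ind : Bool → ℚ
  ind true  = Data.Rational.1ℚ
    where import Data.Rational
  ind false = 0ℚ

  rateFrom : (Fin n → Fin m → ℚ) → ℕ → Fin n → Fin m → ℚ
  rateFrom c t k i =
    (wt k * ind (active t k i (c k i)))
      ÷₀ ΣF (λ l → wt l * ind (active t l i (c l i)))

  cum : ℕ → Fin n → Fin m → ℚ
  cum zero    k i = 0ℚ
  cum (suc t) k i = cum t k i + rateFrom (cum t) t k i

  rate : Fin n → Fin m → ℕ → ℚ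
  rate k i t = rateFrom (cum t) t k i

concSchedule : ∀ {m n} → Instance m n → Schedule m n
concSchedule I k i j t with i ≟F j
... | yes _ = Conc.rate I k i t
... | no  _ = 0ℚ

-- At every port the allocation is weighted processor sharing, so the port is saturated in
-- every slot in which one of its flows stays unfinished.  If coflow k is unfinished at time t,
-- so is one of its flows (i, i), and t ≤ R_k + G_ik, where G_ik counts the slots in which that
-- flow is alive and stays unfinished.  Summed with weights w_k, these slots collect, for every
-- pair (k, l) at port i, w_k times the work l receives while k is busy.  As rates are
-- proportional to weights this is at most w_l d_ik, and also at most w_k d_il plus the work l
-- receives in its own last slot.  Charge the pair to whichever of k, l finishes first in any
-- feasible schedule with completion times C: its port i must have sent all flows finished by
-- C_k within C_k slots, so Σ_k w_k G_ik ≤ 3 Σ_k w_k C_k over the coflows using port i.  With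
-- R_k + 1 ≤ C_k this gives a factor 4 per port, and each coflow uses at most p ports.

{-# OPTIONS --safe #-}
module Submission where

open import Defs
open import Data.Nat using (ℕ)
open import Data.Fin using (Fin)
open import Data.Product using (Σ; _×_)
open import Data.Rational using (_≤_; _*_)

open import Data.Nat as ℕ using (zero; suc; z≤n; s≤s)
import Data.Nat.Properties as ℕₚ
import Data.Integer as ℤ
import Data.Integer.Properties as ℤₚ
open import Data.Nat.Coprimality using (1-coprimeTo) renaming (sym to coprime-sym)
open import Data.Fin using (zero; suc; punchIn)
import Data.Fin.Properties as Finₚ
open import Data.List using (tabulate)
import Data.List
open import Data.Bool using (Bool; true; false; T; not; _∧_; _∨_; if_then_else_)
open import Data.Bool.Properties using (T-∧; T-∨; ∨-comm)
open import Data.Rational hiding (_≤_; _*_; floor; ceiling; truncate)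
open import Data.Rational.Properties
open import Data.Product using (∃; _,_; proj₁; proj₂)
open import Data.Sum using (_⊎_; inj₁; inj₂; [_,_])
open import Function using (_∘_; Equivalence)
open import Relation.Nullary using (¬_; Dec; yes; no; contradiction)
open import Relation.Nullary.Decidable using (⌊_⌋; toWitness; fromWitness; T?)
open import Relation.Binary.PropositionalEquality
  using (_≡_; _≢_; refl; sym; trans; cong; cong₂; subst; subst₂; module ≡-Reasoning)
import Algebra.Solver.Ring.Simple as Solver
open import Algebra.Solver.Ring.AlmostCommutativeRing using (fromCommutativeRing)
open import Algebra.Bundles using (CommutativeRing)
open import Algebra.Properties.Semiring.Sum (CommutativeRing.semiring +-*-commutativeRing)
  using (sum; ∑-distrib-+; ∑-comm; *-distribˡ-sum; *-distribʳ-sum; sum-remove; sum-replicate-zero; sum-cong-≗)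

module ℚ-Solver = Solver (fromCommutativeRing +-*-commutativeRing) _≟_

p≤p+q : ∀ {p q} → 0ℚ ≤ q → p ≤ p + q
p≤p+q {p} 0≤q = subst (_≤ p + _) (+-identityʳ p) (+-monoʳ-≤ p 0≤q)

q≤p+q : ∀ {p q} → 0ℚ ≤ p → q ≤ p + q
q≤p+q {p} {q} 0≤p = subst (q ≤_) (+-comm q p) (p≤p+q 0≤p)

+-nonneg : ∀ {p q} → 0ℚ ≤ p → 0ℚ ≤ q → 0ℚ ≤ p + q
+-nonneg 0≤p 0≤q = ≤-trans 0≤p (p≤p+q 0≤q)

*-monoˡ-≤-nonneg : ∀ {r p q} → 0ℚ ≤ r → p ≤ q → r * p ≤ r * q
*-monoˡ-≤-nonneg {r} 0≤r = *-monoˡ-≤-nonNeg r {{nonNegative 0≤r}}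

*-monoʳ-≤-nonneg : ∀ {r p q} → 0ℚ ≤ r → p ≤ q → p * r ≤ q * r
*-monoʳ-≤-nonneg {r} 0≤r = *-monoʳ-≤-nonNeg r {{nonNegative 0≤r}}

*-nonneg : ∀ {p q} → 0ℚ ≤ p → 0ℚ ≤ q → 0ℚ ≤ p * q
*-nonneg {p} 0≤p 0≤q = subst (_≤ p * _) (*-zeroʳ p) (*-monoˡ-≤-nonneg 0≤p 0≤q)

*-≤ˡ : ∀ {p q} → 0ℚ ≤ q → p ≤ 1ℚ → p * q ≤ q
*-≤ˡ {p} {q} 0≤q p≤1 = subst (p * q ≤_) (*-identityˡ q) (*-monoʳ-≤-nonneg 0≤q p≤1)

0≤1 : 0ℚ ≤ 1ℚ
0≤1 = ≤ᵇ⇒≤ _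

<⇒≱ : ∀ {p q} → p < q → ¬ q ≤ p
<⇒≱ p<q q≤p = <-irrefl refl (<-≤-trans p<q q≤p)

-- `ℕ→ℚ n` is the normalised fraction `+ n / 1`; on its literal form `+` and `*` compute.
ℕ→ℚ≡mkℚ : ∀ n → ℕ→ℚ n ≡ mkℚ (ℤ.+ n) 0 (coprime-sym (1-coprimeTo n))
ℕ→ℚ≡mkℚ n = normalize-coprime _

ℕ→ℚ-+ : ∀ a b → ℕ→ℚ (a ℕ.+ b) ≡ ℕ→ℚ a + ℕ→ℚ b
ℕ→ℚ-+ a b rewrite ℕ→ℚ≡mkℚ a | ℕ→ℚ≡mkℚ b | ℕₚ.*-identityʳ a | ℕₚ.*-identityʳ b
                | ℤₚ.+◃n≡+n a | ℤₚ.+◃n≡+n b = refl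

ℕ→ℚ-* : ∀ a b → ℕ→ℚ (a ℕ.* b) ≡ ℕ→ℚ a * ℕ→ℚ b
ℕ→ℚ-* a b rewrite ℕ→ℚ≡mkℚ a | ℕ→ℚ≡mkℚ b | ℤₚ.+◃n≡+n (a ℕ.* b) = refl

ℕ→ℚ-suc : ∀ n → ℕ→ℚ (suc n) ≡ ℕ→ℚ n + 1ℚ
ℕ→ℚ-suc n = trans (cong ℕ→ℚ (ℕₚ.+-comm 1 n)) (ℕ→ℚ-+ n 1)

ℕ→ℚ-nonneg : ∀ n → 0ℚ ≤ ℕ→ℚ n
ℕ→ℚ-nonneg zero    = ≤-refl
ℕ→ℚ-nonneg (suc n) = subst (0ℚ ≤_) (sym (ℕ→ℚ-suc n)) (+-nonneg (ℕ→ℚ-nonneg n) 0≤1)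

ℕ→ℚ-mono-≤ : ∀ {a b} → a ℕ.≤ b → ℕ→ℚ a ≤ ℕ→ℚ b
ℕ→ℚ-mono-≤ {a} {b} a≤b = subst (ℕ→ℚ a ≤_) b≡a+[b∸a] (p≤p+q (ℕ→ℚ-nonneg (b ℕ.∸ a)))
  where
  b≡a+[b∸a] : ℕ→ℚ a + ℕ→ℚ (b ℕ.∸ a) ≡ ℕ→ℚ b
  b≡a+[b∸a] = trans (sym (ℕ→ℚ-+ a (b ℕ.∸ a))) (cong ℕ→ℚ (ℕₚ.m+[n∸m]≡n a≤b))

ℕ→ℚ-archimedean : ∀ q → ∃ λ M → q < ℕ→ℚ M
ℕ→ℚ-archimedean q@(mkℚ ℤ.-[1+ _ ] _ _) = 0 , negative⁻¹ q
ℕ→ℚ-archimedean q@(mkℚ (ℤ.+ a) _ _)   = suc a , ≤-<-trans q≤a a<1+a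
  where
  q≤a : q ≤ ℕ→ℚ a
  q≤a = subst (q ≤_) (sym (ℕ→ℚ≡mkℚ a)) (*≤* (ℤₚ.*-monoˡ-≤-nonNeg (ℤ.+ a) (ℤ.+≤+ (s≤s z≤n))))
  a<1+a : ℕ→ℚ a < ℕ→ℚ (suc a)
  a<1+a = subst₂ _<_ (+-identityʳ _) (sym (ℕ→ℚ-suc a)) (+-monoʳ-< (ℕ→ℚ a) (positive⁻¹ 1ℚ))

inv₀ : ℚ → ℚ
inv₀ q = 1ℚ ÷₀ q

÷₀≡*inv₀ : ∀ p q → p ÷₀ q ≡ p * inv₀ q
÷₀≡*inv₀ p q with q ≟ 0ℚ
... | yes _ = sym (*-zeroʳ p)
... | no  _ = cong (p *_) (sym (*-identityˡ _))

*-inv₀ : ∀ {q} → q ≢ 0ℚ → q * inv₀ q ≡ 1ℚ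
*-inv₀ {q} q≢0 with q ≟ 0ℚ
... | yes q≡0 = contradiction q≡0 q≢0
... | no  q≢0 = trans (cong (q *_) (*-identityˡ _)) (*-inverseʳ q {{≢-nonZero q≢0}})

*-inv₀-≤1 : ∀ q → q * inv₀ q ≤ 1ℚ
*-inv₀-≤1 q with q ≟ 0ℚ
... | yes _   = subst (_≤ 1ℚ) (sym (*-zeroʳ q)) 0≤1
... | no  q≢0 = ≤-reflexive (trans (cong (q *_) (*-identityˡ _)) (*-inverseʳ q {{≢-nonZero q≢0}}))

inv₀-nonneg : ∀ {q} → 0ℚ ≤ q → 0ℚ ≤ inv₀ q
inv₀-nonneg {q} 0≤q with q ≟ 0ℚ
... | yes _   = ≤-refl
... | no  q≢0 = subst (0ℚ ≤_) (sym (*-identityˡ (1/ q))) (<⇒≤ (positive⁻¹ (1/ q) {{1/q>0}}))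
  where
  instance
    _ : NonZero q
    _ = ≢-nonZero q≢0
  1/q>0 : Positive (1/ q)
  1/q>0 = 1/pos⇒pos q {{nonNeg∧nonZero⇒pos q {{nonNegative 0≤q}}}}

ΣF≡sum : ∀ {k} (f : Fin k → ℚ) → ΣF f ≡ sum f
ΣF≡sum {k} f = foldr-tabulate (λ x → x)
  where
  foldr-tabulate : ∀ {j} (g : Fin j → Fin k) →
                   Data.List.foldr (λ i acc → f i + acc) 0ℚ (tabulate g) ≡ sum (f ∘ g)
  foldr-tabulate {zero}  g = refl
  foldr-tabulate {suc j} g = cong (f (g zero) +_) (foldr-tabulate (g ∘ suc))

sum-mono-≤ : ∀ {k} {f g : Fin k → ℚ} → (∀ x → f x ≤ g x) → sum f ≤ sum g
sum-mono-≤ {zero}  f≤g = ≤-refl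
sum-mono-≤ {suc k} f≤g = +-mono-≤ (f≤g zero) (sum-mono-≤ (f≤g ∘ suc))

sum-nonneg : ∀ {k} {f : Fin k → ℚ} → (∀ x → 0ℚ ≤ f x) → 0ℚ ≤ sum f
sum-nonneg {k} {f} 0≤f = subst (_≤ sum f) (sum-replicate-zero k) (sum-mono-≤ 0≤f)

ΣF-nonneg : ∀ {k} {f : Fin k → ℚ} → (∀ x → 0ℚ ≤ f x) → 0ℚ ≤ ΣF f
ΣF-nonneg {f = f} 0≤f = subst (0ℚ ≤_) (sym (ΣF≡sum f)) (sum-nonneg 0≤f)

≤-sum : ∀ {k} {f : Fin k → ℚ} → (∀ x → 0ℚ ≤ f x) → ∀ j → f j ≤ sum f
≤-sum {suc k} {f} 0≤f j =
  subst (f j ≤_) (sym (sum-remove {i = j} f)) (p≤p+q (sum-nonneg (0≤f ∘ punchIn j)))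

sum-single : ∀ {k} {f : Fin k → ℚ} j → (∀ x → x ≢ j → f x ≡ 0ℚ) → sum f ≡ f j
sum-single {suc k} {f} j f≡0 = begin
  sum f                      ≡⟨ sum-remove {i = j} f ⟩
  f j + sum (f ∘ punchIn j)  ≡⟨ cong (f j +_) (trans (sum-cong-≗ (λ x → f≡0 _ (Finₚ.punchInᵢ≢i j x)))
                                                     (sum-replicate-zero k)) ⟩
  f j + 0ℚ                   ≡⟨ +-identityʳ (f j) ⟩
  f j                        ∎
  where open ≡-Reasoning

∑∑-symmetrise : ∀ {k} (f g : Fin k → Fin k → ℚ) →
  sum (λ x → sum (λ y → (f x y + f y x) + g x y)) ≡
  (sum (λ x → sum (f x)) + sum (λ x → sum (f x))) + sum (λ y → sum (λ x → g x y))
∑∑-symmetrise f g = begin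
  sum (λ x → sum (λ y → (f x y + f y x) + g x y))
    ≡⟨ sum-cong-≗ split ⟩
  sum (λ x → (sum (f x) + sum (λ y → f y x)) + sum (g x))
    ≡⟨ ∑-distrib-+ (λ x → sum (f x) + sum (λ y → f y x)) (λ x → sum (g x)) ⟩
  sum (λ x → sum (f x) + sum (λ y → f y x)) + sum (λ x → sum (g x))
    ≡⟨ cong (_+ sum (λ x → sum (g x))) (∑-distrib-+ (λ x → sum (f x)) (λ x → sum (λ y → f y x))) ⟩
  (sum (λ x → sum (f x)) + sum (λ x → sum (λ y → f y x))) + sum (λ x → sum (g x))
    ≡⟨ cong₂ (λ a b → (sum (λ x → sum (f x)) + a) + b) (∑-comm (λ x y → f y x)) (∑-comm g) ⟩
  (sum (λ x → sum (f x)) + sum (λ x → sum (f x))) + sum (λ y → sum (λ x → g x y))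
    ∎
  where
  open ≡-Reasoning
  split : ∀ x → sum (λ y → (f x y + f y x) + g x y) ≡ (sum (f x) + sum (λ y → f y x)) + sum (g x)
  split x = trans (∑-distrib-+ (λ y → f x y + f y x) (g x))
                  (cong (_+ sum (g x)) (∑-distrib-+ (f x) (λ y → f y x)))

Σ<-cong : ∀ t {f g : ℕ → ℚ} → (∀ s → f s ≡ g s) → Σ< t f ≡ Σ< t g
Σ<-cong zero    f≡g = refl
Σ<-cong (suc t) f≡g = cong₂ _+_ (Σ<-cong t f≡g) (f≡g t)

Σ<-mono-≤ : ∀ t {f g : ℕ → ℚ} → (∀ s → f s ≤ g s) → Σ< t f ≤ Σ< t g
Σ<-mono-≤ zero    f≤g = ≤-refl
Σ<-mono-≤ (suc t) f≤g = +-mono-≤ (Σ<-mono-≤ t f≤g) (f≤g t)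

Σ<-zero : ∀ t {f : ℕ → ℚ} → (∀ s → s ℕ.< t → f s ≡ 0ℚ) → Σ< t f ≡ 0ℚ
Σ<-zero zero    f≡0 = refl
Σ<-zero (suc t) f≡0 = trans (cong₂ _+_ (Σ<-zero t (λ s s<t → f≡0 s (ℕₚ.m<n⇒m<1+n s<t)))
                                       (f≡0 t (ℕₚ.n<1+n t)))
                            (+-identityʳ 0ℚ)

Σ<-nonneg : ∀ t {f : ℕ → ℚ} → (∀ s → 0ℚ ≤ f s) → 0ℚ ≤ Σ< t f
Σ<-nonneg t {f} 0≤f = subst (_≤ Σ< t f) (Σ<-zero t (λ _ _ → refl)) (Σ<-mono-≤ t 0≤f)

Σ<-distrib-+ : ∀ t (f g : ℕ → ℚ) → Σ< t (λ s → f s + g s) ≡ Σ< t f + Σ< t g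
Σ<-distrib-+ zero    f g = sym (+-identityʳ 0ℚ)
Σ<-distrib-+ (suc t) f g = trans (cong (_+ (f t + g t)) (Σ<-distrib-+ t f g))
                                 (+-interchange (Σ< t f) (Σ< t g) (f t) (g t))
  where
  +-interchange : ∀ a b c d → (a + b) + (c + d) ≡ (a + c) + (b + d)
  +-interchange = solve 4 (λ a b c d → (a :+ b) :+ (c :+ d) := (a :+ c) :+ (b :+ d)) refl
    where open ℚ-Solver

*-distribˡ-Σ< : ∀ t c (f : ℕ → ℚ) → c * Σ< t f ≡ Σ< t (λ s → c * f s)
*-distribˡ-Σ< zero    c f = *-zeroʳ c
*-distribˡ-Σ< (suc t) c f =
  trans (*-distribˡ-+ c (Σ< t f) (f t)) (cong (_+ c * f t) (*-distribˡ-Σ< t c f))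

*-distribʳ-Σ< : ∀ t c (f : ℕ → ℚ) → Σ< t f * c ≡ Σ< t (λ s → f s * c)
*-distribʳ-Σ< t c f = trans (*-comm (Σ< t f) c)
                            (trans (*-distribˡ-Σ< t c f) (Σ<-cong t (λ s → *-comm c (f s))))

Σ<-comm-sum : ∀ {k} t (f : Fin k → ℕ → ℚ) → sum (λ x → Σ< t (f x)) ≡ Σ< t (λ s → sum (λ x → f x s))
Σ<-comm-sum {k} zero    f = sum-replicate-zero k
Σ<-comm-sum     (suc t) f = trans (∑-distrib-+ (λ x → Σ< t (f x)) (λ x → f x t))
                                  (cong (_+ sum (λ x → f x t)) (Σ<-comm-sum t f))

Σ<-≤-length : ∀ t {f : ℕ → ℚ} → (∀ s → f s ≤ 1ℚ) → Σ< t f ≤ ℕ→ℚ t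
Σ<-≤-length zero    f≤1 = ≤-refl
Σ<-≤-length (suc t) f≤1 =
  subst (Σ< (suc t) _ ≤_) (sym (ℕ→ℚ-suc t)) (+-mono-≤ (Σ<-≤-length t f≤1) (f≤1 t))

Σ<-mono-length : ∀ {f : ℕ → ℚ} → (∀ s → 0ℚ ≤ f s) → ∀ {t u} → t ℕ.≤ u → Σ< t f ≤ Σ< u f
Σ<-mono-length {f} 0≤f t≤u = go (ℕₚ.≤⇒≤′ t≤u)
  where
  go : ∀ {t u} → t ℕ.≤′ u → Σ< t f ≤ Σ< u f
  go ℕ.≤′-refl        = ≤-refl
  go (ℕ.≤′-step t≤′u) = ≤-trans (go t≤′u) (p≤p+q (0≤f _))

≤-maxF : ∀ {k} (f : Fin k → ℕ) j → f j ℕ.≤ maxF f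
≤-maxF {k} f = go (λ x → x)
  where
  go : ∀ {j} (g : Fin j → Fin k) x →
       f (g x) ℕ.≤ Data.List.foldr (λ i acc → f i ℕ.⊔ acc) 0 (tabulate g)
  go g zero    = ℕₚ.m≤m⊔n (f (g zero)) _
  go g (suc x) = ℕₚ.≤-trans (go (g ∘ suc) x) (ℕₚ.m≤n⊔m (f (g zero)) _)

module _ {P : ℕ → Set} where

  IsFirst : ℕ → Set
  IsFirst t = P t × (∀ t′ → t′ ℕ.< t → ¬ P t′)

  private
    search : (∀ t → Dec (P t)) → ∀ M → (∀ t → t ℕ.< M → ¬ P t) ⊎ Σ ℕ IsFirst
    search P? zero = inj₁ (λ _ ())
    search P? (suc M) with search P? M
    ... | inj₂ first = inj₂ first
    ... | inj₁ none with P? M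
    ...   | yes pM = inj₂ (M , pM , none)
    ...   | no ¬pM = inj₁ λ t t<1+M → [ none t , (λ { refl → ¬pM }) ] (ℕₚ.m<1+n⇒m<n∨m≡n t<1+M)

  first-occurrence : (∀ t → Dec (P t)) → ∀ {M} → P M → Σ ℕ IsFirst
  first-occurrence P? {M} pM with search P? (suc M)
  ... | inj₁ none  = contradiction pM (none M (ℕₚ.n<1+n M))
  ... | inj₂ first = first

T-not⇒¬T : ∀ {b} → T (not b) → ¬ T b
T-not⇒¬T {false} _ ()

-- `ind` lives in the parameterised module `Conc`, hence the instance parameter.
module Indicator {m n : ℕ} (I : Instance m n) where
  open Conc I using (ind)

  ind-T : ∀ {b} → T b → ind b ≡ 1ℚ
  ind-T {true} _ = refl

  ind-F : ∀ {b} → ¬ T b → ind b ≡ 0ℚ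
  ind-F {true}  ¬b = contradiction _ ¬b
  ind-F {false} _  = refl

  ind-nonneg : ∀ b → 0ℚ ≤ ind b
  ind-nonneg true  = 0≤1
  ind-nonneg false = ≤-refl

  ind-≤1 : ∀ b → ind b ≤ 1ℚ
  ind-≤1 true  = ≤-refl
  ind-≤1 false = 0≤1

  ind-≤ : ∀ {b x} → 0ℚ ≤ x → (T b → 1ℚ ≤ x) → ind b ≤ x
  ind-≤ {true}  _   1≤x = 1≤x _
  ind-≤ {false} 0≤x _   = 0≤x

  ind-mono : ∀ {a b} → (T a → T b) → ind a ≤ ind b
  ind-mono {true}  a⇒b = ≤-reflexive (sym (ind-T (a⇒b _)))
  ind-mono {false} {b} _ = ind-nonneg b

  ind-*-monoʳ-≤ : ∀ {b p q} → (T b → p ≤ q) → ind b * p ≤ ind b * q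
  ind-*-monoʳ-≤ {true}  {p} {q} p≤q = subst₂ _≤_ (sym (*-identityˡ p)) (sym (*-identityˡ q)) (p≤q _)
  ind-*-monoʳ-≤ {false} {p} {q} _   = ≤-reflexive (trans (*-zeroˡ p) (sym (*-zeroˡ q)))

  ind-split : ∀ a b → ind a ≡ ind (a ∧ b) + ind (a ∧ not b)
  ind-split true  true  = sym (+-identityʳ 1ℚ)
  ind-split true  false = refl
  ind-split false b     = refl

  ind-*-absorb : ∀ {b x} → (¬ T b → x ≡ 0ℚ) → ind b * x ≡ x
  ind-*-absorb {true}  {x} _   = *-identityˡ x
  ind-*-absorb {false} {x} x≡0 = trans (*-zeroˡ x) (sym (x≡0 λ ()))

  ind-*-one : ∀ {b x} → (T b → x ≡ 1ℚ) → ind b * x ≡ ind b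
  ind-*-one {true}  {x} x≡1 = trans (*-identityˡ x) (x≡1 _)
  ind-*-one {false} {x} _   = *-zeroˡ x

  countF≡∑ind : ∀ {k} (f : Fin k → Bool) → ℕ→ℚ (countF f) ≡ sum (ind ∘ f)
  countF≡∑ind {k} f = go (λ x → x)
    where
    step : ∀ b {a q} → ℕ→ℚ a ≡ q → ℕ→ℚ (if b then suc a else a) ≡ ind b + q
    step true  {a} a≡q = trans (ℕ→ℚ-suc a) (trans (+-comm (ℕ→ℚ a) 1ℚ) (cong (1ℚ +_) a≡q))
    step false     a≡q = trans a≡q (sym (+-identityˡ _))
    go : ∀ {j} (g : Fin j → Fin k) →
         ℕ→ℚ (Data.List.foldr (λ i acc → if f i then suc acc else acc) 0 (tabulate g)) ≡ sum (ind ∘ f ∘ g)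
    go {zero}  g = refl
    go {suc j} g = step (f (g zero)) (go (g ∘ suc))

-- A single port under weighted processor sharing

demand-diag : ∀ {m n} (I : Instance m n) k i → demand I k i i ≡ Instance.dem I k i
demand-diag I k i with i Finₚ.≟ i
... | yes _   = refl
... | no  i≢i = contradiction refl i≢i

module Port {m n : ℕ} (I : Instance m n) (wf : WellFormed I) (i : Fin m) where
  open Instance I
  open Conc I
  open Indicator I

  d : Fin n → ℚ
  d k = dem k i

  -- Spelled exactly as in `Conc.active`, so that `alive` below unfolds to a conjunction with it.
  hasFlow : Fin n → Bool
  hasFlow k = ⌊ 0ℚ <? d k ⌋ ∨ ⌊ d k <? 0ℚ ⌋

  φ : Fin n → ℚ
  φ k = ind (hasFlow k)

  alive : ℕ → Fin n → Bool
  alive t k = active t k i (cum t k i)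

  ρ : Fin n → ℕ → ℚ
  ρ k t = rate k i t

  load : ℕ → ℚ
  load t = ΣF (λ l → wt l * ind (alive t l))

  load≡sum : ∀ t → load t ≡ sum (λ l → wt l * ind (alive t l))
  load≡sum t = ΣF≡sum (λ l → wt l * ind (alive t l))

  wt-pos : ∀ k → 0ℚ < wt k
  wt-pos = proj₂ wf

  wt-nonneg : ∀ k → 0ℚ ≤ wt k
  wt-nonneg k = <⇒≤ (wt-pos k)

  d-nonneg : ∀ k → 0ℚ ≤ d k
  d-nonneg k = proj₁ wf k i

  φ-nonneg : ∀ k → 0ℚ ≤ φ k
  φ-nonneg k = ind-nonneg (hasFlow k)

  d>0⇒hasFlow : ∀ {k} → 0ℚ < d k → T (hasFlow k)
  d>0⇒hasFlow {k} d>0 = Equivalence.from (T-∨ {⌊ 0ℚ <? d k ⌋}) (inj₁ (fromWitness d>0))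

  hasFlow⇒d>0 : ∀ {k} → T (hasFlow k) → 0ℚ < d k
  hasFlow⇒d>0 {k} flow =
    [ toWitness , (λ d<0 → contradiction (d-nonneg k) (<⇒≱ (toWitness d<0))) ]
      (Equivalence.to (T-∨ {⌊ 0ℚ <? d k ⌋}) flow)

  alive-elim : ∀ {t k} → T (alive t k) → rel k ℕ.≤ t × T (hasFlow k) × cum t k i < d k
  alive-elim {t} {k} h = toWitness (proj₁ split) , proj₁ rest , toWitness (proj₂ rest)
    where
    split : T ⌊ rel k ℕ.≤? t ⌋ × T (hasFlow k ∧ ⌊ cum t k i <? d k ⌋)
    split = Equivalence.to (T-∧ {⌊ rel k ℕ.≤? t ⌋}) h
    rest : T (hasFlow k) × T ⌊ cum t k i <? d k ⌋
    rest = Equivalence.to (T-∧ {hasFlow k}) (proj₂ split)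

  alive-intro : ∀ {t k} → rel k ℕ.≤ t → T (hasFlow k) → cum t k i < d k → T (alive t k)
  alive-intro {t} {k} released flow unfinished =
    Equivalence.from (T-∧ {⌊ rel k ℕ.≤? t ⌋})
      (fromWitness released , Equivalence.from (T-∧ {hasFlow k}) (flow , fromWitness unfinished))

  ρ-unfold : ∀ k t → ρ k t ≡ (wt k * ind (alive t k)) * inv₀ (load t)
  ρ-unfold k t = ÷₀≡*inv₀ (wt k * ind (alive t k)) (load t)

  load-nonneg : ∀ t → 0ℚ ≤ load t
  load-nonneg t = subst (0ℚ ≤_) (sym (load≡sum t))
                        (sum-nonneg (λ l → *-nonneg (wt-nonneg l) (ind-nonneg (alive t l))))

  ρ-nonneg : ∀ k t → 0ℚ ≤ ρ k t
  ρ-nonneg k t = subst (0ℚ ≤_) (sym (ρ-unfold k t))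
    (*-nonneg (*-nonneg (wt-nonneg k) (ind-nonneg (alive t k))) (inv₀-nonneg (load-nonneg t)))

  ρ-dead : ∀ {k t} → ¬ T (alive t k) → ρ k t ≡ 0ℚ
  ρ-dead {k} {t} dead = begin
    ρ k t                                     ≡⟨ ρ-unfold k t ⟩
    (wt k * ind (alive t k)) * inv₀ (load t)  ≡⟨ cong (λ z → (wt k * z) * inv₀ (load t)) (ind-F dead) ⟩
    (wt k * 0ℚ) * inv₀ (load t)               ≡⟨ cong (_* inv₀ (load t)) (*-zeroʳ (wt k)) ⟩
    0ℚ * inv₀ (load t)                        ≡⟨ *-zeroˡ (inv₀ (load t)) ⟩
    0ℚ                                        ∎
    where open ≡-Reasoning

  ∑ρ-unfold : ∀ t → sum (λ l → ρ l t) ≡ load t * inv₀ (load t)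
  ∑ρ-unfold t = begin
    sum (λ l → ρ l t)
      ≡⟨ sum-cong-≗ (λ l → ρ-unfold l t) ⟩
    sum (λ l → (wt l * ind (alive t l)) * inv₀ (load t))
      ≡⟨ *-distribʳ-sum (inv₀ (load t)) (λ l → wt l * ind (alive t l)) ⟨
    sum (λ l → wt l * ind (alive t l)) * inv₀ (load t)
      ≡⟨ cong (_* inv₀ (load t)) (load≡sum t) ⟨
    load t * inv₀ (load t)
      ∎
    where open ≡-Reasoning

  ∑ρ≤1 : ∀ t → sum (λ l → ρ l t) ≤ 1ℚ
  ∑ρ≤1 t = subst (_≤ 1ℚ) (sym (∑ρ-unfold t)) (*-inv₀-≤1 (load t))

  ∑ρ≡1 : ∀ {t k} → T (alive t k) → sum (λ l → ρ l t) ≡ 1ℚ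
  ∑ρ≡1 {t} {k} alive-k =
    trans (∑ρ-unfold t) (*-inv₀ (λ load≡0 → <⇒≱ (wt-pos k) (subst (wt k ≤_) load≡0 wt≤load)))
    where
    wt≤load : wt k ≤ load t
    wt≤load = subst₂ _≤_ (trans (cong (wt k *_) (ind-T alive-k)) (*-identityʳ (wt k)))
                         (sym (load≡sum t))
                         (≤-sum (λ l → *-nonneg (wt-nonneg l) (ind-nonneg (alive t l))) k)

  ρ≤1 : ∀ k t → ρ k t ≤ 1ℚ
  ρ≤1 k t = ≤-trans (≤-sum (λ l → ρ-nonneg l t) k) (∑ρ≤1 t)

  ρ-cross-alive : ∀ {t k} l → T (alive t k) → wt k * ρ l t ≤ wt l * ρ k t
  ρ-cross-alive {t} {k} l alive-k = begin
    wt k * ρ l t                                   ≡⟨ cong (wt k *_) (ρ-unfold l t) ⟩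
    wt k * ((wt l * ind (alive t l)) * inv₀ (load t))
      ≡⟨ rearrange (wt k) (wt l) (ind (alive t l)) (inv₀ (load t)) ⟩
    ind (alive t l) * (wt l * ((wt k * 1ℚ) * inv₀ (load t)))
      ≤⟨ *-≤ˡ (*-nonneg (wt-nonneg l) (subst (0ℚ ≤_) ρk≡ (ρ-nonneg k t))) (ind-≤1 (alive t l)) ⟩
    wt l * ((wt k * 1ℚ) * inv₀ (load t))           ≡⟨ cong (wt l *_) ρk≡ ⟨
    wt l * ρ k t                                   ∎
    where
    open ≤-Reasoning
    ρk≡ : ρ k t ≡ (wt k * 1ℚ) * inv₀ (load t)
    ρk≡ = trans (ρ-unfold k t) (cong (λ z → (wt k * z) * inv₀ (load t)) (ind-T alive-k))
    rearrange : ∀ a b c e → a * ((b * c) * e) ≡ c * (b * ((a * 1ℚ) * e))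
    rearrange = solve 4 (λ a b c e → a :* ((b :* c) :* e) := c :* (b :* ((a :* con 1ℚ) :* e))) refl
      where open ℚ-Solver

  ρ-cross : ∀ {b} t k l → (T b → T (alive t k)) → (wt k * ind b) * ρ l t ≤ wt l * (ind b * ρ k t)
  ρ-cross {true}  t k l alive-k =
    subst₂ _≤_ (cong (_* ρ l t) (sym (*-identityʳ (wt k)))) (cong (wt l *_) (sym (*-identityˡ (ρ k t))))
           (ρ-cross-alive l (alive-k _))
  ρ-cross {false} t k l _ =
    ≤-reflexive (trans (trans (cong (_* ρ l t) (*-zeroʳ (wt k))) (*-zeroˡ (ρ l t)))
                       (sym (trans (cong (wt l *_) (*-zeroˡ (ρ k t))) (*-zeroʳ (wt l)))))

  cum≡Σ<ρ : ∀ t k → cum t k i ≡ Σ< t (ρ k)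
  cum≡Σ<ρ zero    k = refl
  cum≡Σ<ρ (suc t) k = cong (_+ ρ k t) (cum≡Σ<ρ t k)

  cum-nonneg : ∀ t k → 0ℚ ≤ cum t k i
  cum-nonneg t k = subst (0ℚ ≤_) (sym (cum≡Σ<ρ t k)) (Σ<-nonneg t (ρ-nonneg k))

  cum-step : ∀ t k → cum t k i ≤ cum (suc t) k i
  cum-step t k = p≤p+q (ρ-nonneg k t)

  cum≤d+1 : ∀ t k → cum t k i ≤ d k + 1ℚ
  cum≤d+1 zero    k = +-nonneg (d-nonneg k) 0≤1
  cum≤d+1 (suc t) k = step (T? (alive t k))
    where
    step : Dec (T (alive t k)) → cum (suc t) k i ≤ d k + 1ℚ
    step (yes alive-k) = +-mono-≤ (<⇒≤ (proj₂ (proj₂ (alive-elim alive-k)))) (ρ≤1 k t)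
    step (no  dead)    =
      subst (_≤ d k + 1ℚ) (sym (trans (cong (cum t k i +_) (ρ-dead dead)) (+-identityʳ _))) (cum≤d+1 t k)

  busy : Fin n → ℕ → Bool
  busy k s = alive s k ∧ alive (suc s) k

  finishing : Fin n → ℕ → Bool
  finishing k s = alive s k ∧ not (alive (suc s) k)

  busyTime : Fin n → ℕ → ℚ
  busyTime k t = Σ< t (ind ∘ busy k)

  busyTime-nonneg : ∀ k t → 0ℚ ≤ busyTime k t
  busyTime-nonneg k t = Σ<-nonneg t (ind-nonneg ∘ busy k)

  busy⇒alive : ∀ {k s} → T (busy k s) → T (alive s k)
  busy⇒alive {k} {s} = proj₁ ∘ Equivalence.to (T-∧ {alive s k})

  busy⇒alive-next : ∀ {k s} → T (busy k s) → T (alive (suc s) k)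
  busy⇒alive-next {k} {s} = proj₂ ∘ Equivalence.to (T-∧ {alive s k})

  ρ-split : ∀ k s → ρ k s ≡ ind (busy k s) * ρ k s + ind (finishing k s) * ρ k s
  ρ-split k s = begin
    ρ k s
      ≡⟨ ind-*-absorb ρ-dead ⟨
    ind (alive s k) * ρ k s
      ≡⟨ cong (_* ρ k s) (ind-split (alive s k) (alive (suc s) k)) ⟩
    (ind (busy k s) + ind (finishing k s)) * ρ k s
      ≡⟨ *-distribʳ-+ (ρ k s) (ind (busy k s)) (ind (finishing k s)) ⟩
    ind (busy k s) * ρ k s + ind (finishing k s) * ρ k s
      ∎
    where open ≡-Reasoning

  unfinished⇒busy : ∀ {k s} → rel k ℕ.≤ s → cum (suc s) k i < d k → T (busy k s)
  unfinished⇒busy {k} {s} released unfinished = Equivalence.from (T-∧ {alive s k})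
    ( alive-intro released flow (≤-<-trans (cum-step s k) unfinished)
    , alive-intro (ℕₚ.m≤n⇒m≤1+n released) flow unfinished )
    where
    flow : T (hasFlow k)
    flow = d>0⇒hasFlow (≤-<-trans (cum-nonneg (suc s) k) unfinished)

  elapsed≤busyTime : ∀ t k → cum t k i < d k → rel k ℕ.≤ t → ℕ→ℚ (t ℕ.∸ rel k) ≤ busyTime k t
  elapsed≤busyTime zero    k _ _ = subst (λ e → ℕ→ℚ e ≤ 0ℚ) (sym (ℕₚ.0∸n≡0 (rel k))) ≤-refl
  elapsed≤busyTime (suc t) k unfinished _ = step (ℕₚ.≤-<-connex (rel k) t)
    where
    open ≤-Reasoning
    step : rel k ℕ.≤ t ⊎ t ℕ.< rel k → ℕ→ℚ (suc t ℕ.∸ rel k) ≤ busyTime k (suc t)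
    step (inj₂ t<r) = subst (λ e → ℕ→ℚ e ≤ busyTime k (suc t)) (sym (ℕₚ.m≤n⇒m∸n≡0 t<r))
                            (busyTime-nonneg k (suc t))
    step (inj₁ r≤t) = begin
      ℕ→ℚ (suc t ℕ.∸ rel k)          ≡⟨ cong ℕ→ℚ (ℕₚ.+-∸-assoc 1 r≤t) ⟩
      ℕ→ℚ (suc (t ℕ.∸ rel k))        ≡⟨ ℕ→ℚ-suc (t ℕ.∸ rel k) ⟩
      ℕ→ℚ (t ℕ.∸ rel k) + 1ℚ         ≤⟨ +-mono-≤ (elapsed≤busyTime t k still-unfinished r≤t) busy-now ⟩
      busyTime k t + ind (busy k t)  ∎
      where
      still-unfinished : cum t k i < d k
      still-unfinished = ≤-<-trans (cum-step t k) unfinished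
      busy-now : 1ℚ ≤ ind (busy k t)
      busy-now = ≤-reflexive (sym (ind-T (unfinished⇒busy r≤t unfinished)))

  busy≤∑ρ : ∀ k s → ind (busy k s) ≤ sum (λ l → ρ l s)
  busy≤∑ρ k s =
    ind-≤ (sum-nonneg (λ l → ρ-nonneg l s)) (λ b → ≤-reflexive (sym (∑ρ≡1 (busy⇒alive b))))

  busyTime≤∑cum : ∀ t k → busyTime k t ≤ sum (λ l → cum t l i)
  busyTime≤∑cum t k = begin
    busyTime k t                    ≤⟨ Σ<-mono-≤ t (busy≤∑ρ k) ⟩
    Σ< t (λ s → sum (λ l → ρ l s))  ≡⟨ Σ<-comm-sum t ρ ⟨
    sum (λ l → Σ< t (ρ l))          ≡⟨ sum-cong-≗ (λ l → cum≡Σ<ρ t l) ⟨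
    sum (λ l → cum t l i)           ∎
    where open ≤-Reasoning

  elapsed≤∑[d+1] : ∀ t k → cum t k i < d k → rel k ℕ.≤ t →
                   ℕ→ℚ (t ℕ.∸ rel k) ≤ sum (λ l → d l + 1ℚ)
  elapsed≤∑[d+1] t k unfinished released =
    ≤-trans (elapsed≤busyTime t k unfinished released)
            (≤-trans (busyTime≤∑cum t k) (sum-mono-≤ (cum≤d+1 t)))

  Σ<busyρ≤cum : ∀ t k → Σ< t (λ s → ind (busy k s) * ρ k s) ≤ cum t k i
  Σ<busyρ≤cum t k = subst (Σ< t (λ s → ind (busy k s) * ρ k s) ≤_) (sym (cum≡Σ<ρ t k))
                          (Σ<-mono-≤ t (λ s → *-≤ˡ (ρ-nonneg k s) (ind-≤1 (busy k s))))

  -- The last busy slot before t is followed by a slot in which the flow is still unfinished.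
  Σ<busyρ≤d : ∀ t k → Σ< t (λ s → ind (busy k s) * ρ k s) ≤ d k
  Σ<busyρ≤d zero    k = d-nonneg k
  Σ<busyρ≤d (suc t) k = step (T? (busy k t))
    where
    step : Dec (T (busy k t)) → Σ< (suc t) (λ s → ind (busy k s) * ρ k s) ≤ d k
    step (yes b)  =
      <⇒≤ (≤-<-trans (Σ<busyρ≤cum (suc t) k) (proj₂ (proj₂ (alive-elim (busy⇒alive-next b)))))
    step (no  ¬b) = subst (_≤ d k) (sym (trans (cong (Σ< t (λ s → ind (busy k s) * ρ k s) +_) idle)
                                               (+-identityʳ _)))
                          (Σ<busyρ≤d t k)
      where
      idle : ind (busy k t) * ρ k t ≡ 0ℚ
      idle = trans (cong (_* ρ k t) (ind-F ¬b)) (*-zeroˡ (ρ k t))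

  done : ℕ → Fin n → Bool
  done t k = hasFlow k ∧ ⌊ d k ≤? cum t k i ⌋

  done-step : ∀ {t k} → T (done t k) → T (done (suc t) k)
  done-step {t} {k} h = Equivalence.from (T-∧ {hasFlow k})
    (proj₁ split , fromWitness (≤-trans (toWitness (proj₂ split)) (cum-step t k)))
    where
    split : T (hasFlow k) × T ⌊ d k ≤? cum t k i ⌋
    split = Equivalence.to (T-∧ {hasFlow k}) h

  finishing⇒done-next : ∀ {k s} → T (finishing k s) → ¬ T (done s k) × T (done (suc s) k)
  finishing⇒done-next {k} {s} h =
    not-done , Equivalence.from (T-∧ {hasFlow k}) (flow , fromWitness d≤cum)
    where
    split : T (alive s k) × T (not (alive (suc s) k))
    split = Equivalence.to (T-∧ {alive s k}) h
    facts : rel k ℕ.≤ s × T (hasFlow k) × cum s k i < d k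
    facts = alive-elim (proj₁ split)
    flow : T (hasFlow k)
    flow = proj₁ (proj₂ facts)
    not-done : ¬ T (done s k)
    not-done done-now =
      <⇒≱ (proj₂ (proj₂ facts)) (toWitness (proj₂ (Equivalence.to (T-∧ {hasFlow k}) done-now)))
    d≤cum : d k ≤ cum (suc s) k i
    d≤cum = ≮⇒≥ (T-not⇒¬T (proj₂ split) ∘ alive-intro (ℕₚ.m≤n⇒m≤1+n (proj₁ facts)) flow)

  Σ<finishing≤done : ∀ t k → Σ< t (ind ∘ finishing k) ≤ ind (done t k)
  Σ<finishing≤done zero    k = ind-nonneg (done zero k)
  Σ<finishing≤done (suc t) k = step (T? (finishing k t))
    where
    open ≤-Reasoning
    step : Dec (T (finishing k t)) → Σ< (suc t) (ind ∘ finishing k) ≤ ind (done (suc t) k)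
    step (yes f) = begin
      Σ< t (ind ∘ finishing k) + ind (finishing k t)
        ≤⟨ +-mono-≤ (subst (Σ< t (ind ∘ finishing k) ≤_) (ind-F (proj₁ (finishing⇒done-next f)))
                           (Σ<finishing≤done t k))
                    (ind-≤1 (finishing k t)) ⟩
      0ℚ + 1ℚ                   ≡⟨ +-identityˡ 1ℚ ⟩
      1ℚ                        ≡⟨ ind-T (proj₂ (finishing⇒done-next f)) ⟨
      ind (done (suc t) k)      ∎
    step (no ¬f) = subst (_≤ ind (done (suc t) k)) (sym no-new-term)
                         (≤-trans (Σ<finishing≤done t k) (ind-mono (done-step {t} {k})))
      where
      no-new-term : Σ< t (ind ∘ finishing k) + ind (finishing k t) ≡ Σ< t (ind ∘ finishing k)
      no-new-term = trans (cong (Σ< t (ind ∘ finishing k) +_) (ind-F ¬f)) (+-identityʳ _)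

  Σ<finishing≤φ : ∀ t k → Σ< t (ind ∘ finishing k) ≤ φ k
  Σ<finishing≤φ t k =
    ≤-trans (Σ<finishing≤done t k) (ind-mono (proj₁ ∘ Equivalence.to (T-∧ {hasFlow k})))

  completionBound : ℕ → Fin n → ℚ
  completionBound N k = (ℕ→ℚ (rel k) + 1ℚ) + busyTime k N

  φ*completionBound-nonneg : ∀ N k → 0ℚ ≤ φ k * completionBound N k
  φ*completionBound-nonneg N k =
    *-nonneg (φ-nonneg k) (+-nonneg (+-nonneg (ℕ→ℚ-nonneg (rel k)) 0≤1) (busyTime-nonneg k N))

  unfinished⇒≤completionBound : ∀ {t N} k → t ℕ.≤ N → cum t k i < d k →
                                ℕ→ℚ (suc t) ≤ φ k * completionBound N k
  unfinished⇒≤completionBound {t} {N} k t≤N unfinished = begin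
    ℕ→ℚ (suc t)                ≤⟨ cases (ℕₚ.≤-<-connex (rel k) t) ⟩
    completionBound N k        ≡⟨ *-identityˡ (completionBound N k) ⟨
    1ℚ * completionBound N k   ≡⟨ cong (_* completionBound N k) (ind-T flow) ⟨
    φ k * completionBound N k  ∎
    where
    open ≤-Reasoning
    flow : T (hasFlow k)
    flow = d>0⇒hasFlow (≤-<-trans (cum-nonneg t k) unfinished)
    cases : rel k ℕ.≤ t ⊎ t ℕ.< rel k → ℕ→ℚ (suc t) ≤ completionBound N k
    cases (inj₁ r≤t) = begin
      ℕ→ℚ (suc t)                              ≡⟨ cong (ℕ→ℚ ∘ suc) (ℕₚ.m+[n∸m]≡n r≤t) ⟨
      ℕ→ℚ (suc (rel k) ℕ.+ (t ℕ.∸ rel k))      ≡⟨ ℕ→ℚ-+ (suc (rel k)) (t ℕ.∸ rel k) ⟩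
      ℕ→ℚ (suc (rel k)) + ℕ→ℚ (t ℕ.∸ rel k)    ≡⟨ cong (_+ ℕ→ℚ (t ℕ.∸ rel k)) (ℕ→ℚ-suc (rel k)) ⟩
      (ℕ→ℚ (rel k) + 1ℚ) + ℕ→ℚ (t ℕ.∸ rel k)   ≤⟨ +-monoʳ-≤ (ℕ→ℚ (rel k) + 1ℚ) elapsed≤busyTime-N ⟩
      completionBound N k                      ∎
      where
      elapsed≤busyTime-N : ℕ→ℚ (t ℕ.∸ rel k) ≤ busyTime k N
      elapsed≤busyTime-N = ≤-trans (elapsed≤busyTime t k unfinished r≤t)
                                   (Σ<-mono-length (ind-nonneg ∘ busy k) t≤N)
    cases (inj₂ t<r) =
      ≤-trans (ℕ→ℚ-mono-≤ t<r) (≤-trans (p≤p+q 0≤1) (p≤p+q (busyTime-nonneg k N)))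

  module Against (x : Schedule m n) (x-feasible : Feasible I x)
                 (C : Fin n → ℕ) (x-finished : ∀ k → FinishedBy I x k (C k)) where

    y : Fin n → ℕ → ℚ
    y k s = x k i i s

    y-nonneg : ∀ k s → 0ℚ ≤ y k s
    y-nonneg k s = proj₁ x-feasible k i i s

    ∑y≤1 : ∀ s → sum (λ k → y k s) ≤ 1ℚ
    ∑y≤1 s = begin
      sum (λ k → y k s)  ≡⟨ ΣF≡sum (λ k → y k s) ⟨
      out i              ≤⟨ ≤-sum (λ j → ΣF-nonneg (λ k → proj₁ x-feasible k i j s)) i ⟩
      sum out            ≡⟨ ΣF≡sum out ⟨
      ΣF out             ≤⟨ proj₁ (proj₂ (proj₂ x-feasible)) i s ⟩
      1ℚ                 ∎
      where
      open ≤-Reasoning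
      out : Fin m → ℚ
      out j = ΣF (λ k → x k i j s)

    d≤Σ<y : ∀ k → d k ≤ Σ< (C k) (y k)
    d≤Σ<y k = subst (_≤ Σ< (C k) (y k)) (demand-diag I k i) (x-finished k i i)

    release<completion : ∀ {k} → T (hasFlow k) → rel k ℕ.< C k
    release<completion {k} flow = ℕₚ.≰⇒> C≰r
      where
      C≰r : ¬ C k ℕ.≤ rel k
      C≰r C≤r = <⇒≱ (hasFlow⇒d>0 flow) (≤-trans (d≤Σ<y k) (≤-reflexive nothing-sent))
        where
        nothing-sent : Σ< (C k) (y k) ≡ 0ℚ
        nothing-sent = Σ<-zero (C k) (λ s s<C → proj₁ (proj₂ x-feasible) k i i s (ℕₚ.<-≤-trans s<C C≤r))

    ∑earlier-d≤completion : ∀ k → sum (λ l → ind ⌊ C l ℕ.≤? C k ⌋ * d l) ≤ ℕ→ℚ (C k)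
    ∑earlier-d≤completion k = begin
      sum (λ l → ind ⌊ C l ℕ.≤? C k ⌋ * d l)  ≤⟨ sum-mono-≤ sent-before-C ⟩
      sum (λ l → Σ< (C k) (y l))              ≡⟨ Σ<-comm-sum (C k) y ⟩
      Σ< (C k) (λ s → sum (λ l → y l s))      ≤⟨ Σ<-≤-length (C k) ∑y≤1 ⟩
      ℕ→ℚ (C k)                               ∎
      where
      open ≤-Reasoning
      sent-before-C : ∀ l → ind ⌊ C l ℕ.≤? C k ⌋ * d l ≤ Σ< (C k) (y l)
      sent-before-C l =
        ≤-trans (ind-*-monoʳ-≤ {⌊ C l ℕ.≤? C k ⌋}
                  (λ Cl≤Ck → ≤-trans (d≤Σ<y l) (Σ<-mono-length (y-nonneg l) (toWitness Cl≤Ck))))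
                (*-≤ˡ (Σ<-nonneg (C k) (y-nonneg l)) (ind-≤1 ⌊ C l ℕ.≤? C k ⌋))

    localCost : ℚ
    localCost = sum (λ k → (φ k * wt k) * ℕ→ℚ (C k))

    φ*[release+1]≤φ*C : ∀ k → φ k * (ℕ→ℚ (rel k) + 1ℚ) ≤ φ k * ℕ→ℚ (C k)
    φ*[release+1]≤φ*C k = ind-*-monoʳ-≤ (λ flow →
      subst (_≤ ℕ→ℚ (C k)) (ℕ→ℚ-suc (rel k)) (ℕ→ℚ-mono-≤ (release<completion flow)))

    ∑φ*wt≤localCost : sum (λ k → φ k * wt k) ≤ localCost
    ∑φ*wt≤localCost = sum-mono-≤ λ k → begin
      φ k * wt k                 ≡⟨ cong (_* wt k) (*-identityʳ (φ k)) ⟨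
      (φ k * 1ℚ) * wt k          ≤⟨ *-monoʳ-≤-nonneg (wt-nonneg k) (ind-*-monoʳ-≤ (1≤C k)) ⟩
      (φ k * ℕ→ℚ (C k)) * wt k   ≡⟨ *-comm-middle (φ k) (ℕ→ℚ (C k)) (wt k) ⟩
      (φ k * wt k) * ℕ→ℚ (C k)   ∎
      where
      open ≤-Reasoning
      1≤C : ∀ k → T (hasFlow k) → 1ℚ ≤ ℕ→ℚ (C k)
      1≤C k flow = ℕ→ℚ-mono-≤ (ℕₚ.≤-trans (s≤s z≤n) (release<completion flow))
      *-comm-middle : ∀ a b c → (a * b) * c ≡ (a * c) * b
      *-comm-middle = solve 3 (λ a b c → (a :* b) :* c := (a :* c) :* b) refl
        where open ℚ-Solver

    module _ (N : ℕ) where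

      crossWork : Fin n → Fin n → ℚ
      crossWork k l = Σ< N (λ s → (wt k * ind (busy k s)) * ρ l s)

      finalCrossWork : Fin n → Fin n → ℚ
      finalCrossWork k l = Σ< N (λ s → (wt k * ind (busy k s)) * (ind (finishing l s) * ρ l s))

      -- The pair (k, l) is charged to whichever of k and l completes first in x.
      charge : Fin n → Fin n → ℚ
      charge k l = φ k * (ind ⌊ C l ℕ.≤? C k ⌋ * (wt k * d l))

      finalCrossWork-nonneg : ∀ k l → 0ℚ ≤ finalCrossWork k l
      finalCrossWork-nonneg k l = Σ<-nonneg N (λ s →
        *-nonneg (*-nonneg (wt-nonneg k) (ind-nonneg (busy k s)))
                 (*-nonneg (ind-nonneg (finishing l s)) (ρ-nonneg l s)))

      charge-nonneg : ∀ k l → 0ℚ ≤ charge k l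
      charge-nonneg k l =
        *-nonneg (φ-nonneg k) (*-nonneg (ind-nonneg ⌊ C l ℕ.≤? C k ⌋) (*-nonneg (wt-nonneg k) (d-nonneg l)))

      charge-flow : ∀ {k l} → T (hasFlow k) → C l ℕ.≤ C k → charge k l ≡ wt k * d l
      charge-flow {k} {l} flow Cl≤Ck = begin
        φ k * (ind ⌊ C l ℕ.≤? C k ⌋ * (wt k * d l))
          ≡⟨ cong₂ (λ a b → a * (b * (wt k * d l)))
                   (ind-T flow) (ind-T {⌊ C l ℕ.≤? C k ⌋} (fromWitness Cl≤Ck)) ⟩
        1ℚ * (1ℚ * (wt k * d l))
          ≡⟨ trans (*-identityˡ _) (*-identityˡ _) ⟩
        wt k * d l
          ∎
        where open ≡-Reasoning

      wt*busyTime≡∑crossWork : ∀ k → wt k * busyTime k N ≡ sum (crossWork k)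
      wt*busyTime≡∑crossWork k = begin
        wt k * busyTime k N
          ≡⟨ *-distribˡ-Σ< N (wt k) (ind ∘ busy k) ⟩
        Σ< N (λ s → wt k * ind (busy k s))
          ≡⟨ Σ<-cong N slot ⟩
        Σ< N (λ s → sum (λ l → (wt k * ind (busy k s)) * ρ l s))
          ≡⟨ Σ<-comm-sum N (λ l s → (wt k * ind (busy k s)) * ρ l s) ⟨
        sum (crossWork k)
          ∎
        where
        open ≡-Reasoning
        slot : ∀ s → wt k * ind (busy k s) ≡ sum (λ l → (wt k * ind (busy k s)) * ρ l s)
        slot s = begin
          wt k * ind (busy k s)                        ≡⟨ cong (wt k *_) (ind-*-one (∑ρ≡1 ∘ busy⇒alive)) ⟨
          wt k * (ind (busy k s) * sum (λ l → ρ l s))  ≡⟨ *-assoc (wt k) (ind (busy k s)) _ ⟨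
          (wt k * ind (busy k s)) * sum (λ l → ρ l s)  ≡⟨ *-distribˡ-sum (wt k * ind (busy k s)) (λ l → ρ l s) ⟩
          sum (λ l → (wt k * ind (busy k s)) * ρ l s)  ∎

      crossWork≤wt*d : ∀ k l → crossWork k l ≤ wt l * d k
      crossWork≤wt*d k l = begin
        crossWork k l
          ≤⟨ Σ<-mono-≤ N (λ s → ρ-cross s k l busy⇒alive) ⟩
        Σ< N (λ s → wt l * (ind (busy k s) * ρ k s))
          ≡⟨ *-distribˡ-Σ< N (wt l) (λ s → ind (busy k s) * ρ k s) ⟨
        wt l * Σ< N (λ s → ind (busy k s) * ρ k s)
          ≤⟨ *-monoˡ-≤-nonneg (wt-nonneg l) (Σ<busyρ≤d N k) ⟩
        wt l * d k
          ∎
        where open ≤-Reasoning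

      crossWork≤wt*d+finalCrossWork : ∀ k l → crossWork k l ≤ wt k * d l + finalCrossWork k l
      crossWork≤wt*d+finalCrossWork k l = begin
        crossWork k l
          ≡⟨ Σ<-cong N (λ s → trans (cong (a s *_) (ρ-split l s)) (*-distribˡ-+ (a s) _ _)) ⟩
        Σ< N (λ s → a s * (ind (busy l s) * ρ l s) + a s * (ind (finishing l s) * ρ l s))
          ≡⟨ Σ<-distrib-+ N (λ s → a s * (ind (busy l s) * ρ l s)) _ ⟩
        Σ< N (λ s → a s * (ind (busy l s) * ρ l s)) + finalCrossWork k l
          ≤⟨ +-monoˡ-≤ (finalCrossWork k l) (Σ<-mono-≤ N a≤wt) ⟩
        Σ< N (λ s → wt k * (ind (busy l s) * ρ l s)) + finalCrossWork k l
          ≡⟨ cong (_+ finalCrossWork k l) (*-distribˡ-Σ< N (wt k) (λ s → ind (busy l s) * ρ l s)) ⟨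
        wt k * Σ< N (λ s → ind (busy l s) * ρ l s) + finalCrossWork k l
          ≤⟨ +-monoˡ-≤ (finalCrossWork k l) (*-monoˡ-≤-nonneg (wt-nonneg k) (Σ<busyρ≤d N l)) ⟩
        wt k * d l + finalCrossWork k l
          ∎
        where
        open ≤-Reasoning
        a : ℕ → ℚ
        a s = wt k * ind (busy k s)
        a≤wt : ∀ s → a s * (ind (busy l s) * ρ l s) ≤ wt k * (ind (busy l s) * ρ l s)
        a≤wt s = *-monoʳ-≤-nonneg (*-nonneg (ind-nonneg (busy l s)) (ρ-nonneg l s))
                   (subst (a s ≤_) (*-identityʳ (wt k)) (*-monoˡ-≤-nonneg (wt-nonneg k) (ind-≤1 (busy k s))))

      crossWork-without-flow : ∀ {k l} → ¬ T (hasFlow k) ⊎ ¬ T (hasFlow l) → crossWork k l ≡ 0ℚ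
      crossWork-without-flow {k} {l} no-flow = Σ<-zero N (λ s _ → [ idle-k s , idle-l s ] no-flow)
        where
        open ≡-Reasoning
        ¬alive : ∀ {k s} → ¬ T (hasFlow k) → ¬ T (alive s k)
        ¬alive ¬flow = ¬flow ∘ proj₁ ∘ proj₂ ∘ alive-elim
        idle-k : ∀ s → ¬ T (hasFlow k) → (wt k * ind (busy k s)) * ρ l s ≡ 0ℚ
        idle-k s ¬flow = begin
          (wt k * ind (busy k s)) * ρ l s
            ≡⟨ cong (λ z → (wt k * z) * ρ l s) (ind-F (¬alive ¬flow ∘ busy⇒alive)) ⟩
          (wt k * 0ℚ) * ρ l s
            ≡⟨ cong (_* ρ l s) (*-zeroʳ (wt k)) ⟩
          0ℚ * ρ l s
            ≡⟨ *-zeroˡ (ρ l s) ⟩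
          0ℚ
            ∎
        idle-l : ∀ s → ¬ T (hasFlow l) → (wt k * ind (busy k s)) * ρ l s ≡ 0ℚ
        idle-l s ¬flow = begin
          (wt k * ind (busy k s)) * ρ l s  ≡⟨ cong (wt k * ind (busy k s) *_) (ρ-dead (¬alive ¬flow)) ⟩
          (wt k * ind (busy k s)) * 0ℚ     ≡⟨ *-zeroʳ (wt k * ind (busy k s)) ⟩
          0ℚ                               ∎

      crossWork≤charges : ∀ k l → crossWork k l ≤ (charge k l + charge l k) + finalCrossWork k l
      crossWork≤charges k l = cases (T? (hasFlow k)) (T? (hasFlow l))
        where
        open ≤-Reasoning
        rhs : ℚ
        rhs = (charge k l + charge l k) + finalCrossWork k l
        rhs-nonneg : 0ℚ ≤ rhs
        rhs-nonneg = +-nonneg (+-nonneg (charge-nonneg k l) (charge-nonneg l k)) (finalCrossWork-nonneg k l)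
        ordered : T (hasFlow k) → T (hasFlow l) → C l ℕ.≤ C k ⊎ C k ℕ.≤ C l → crossWork k l ≤ rhs
        ordered flow-k _ (inj₁ Cl≤Ck) = begin
          crossWork k l                    ≤⟨ crossWork≤wt*d+finalCrossWork k l ⟩
          wt k * d l + finalCrossWork k l  ≡⟨ cong (_+ finalCrossWork k l) (charge-flow flow-k Cl≤Ck) ⟨
          charge k l + finalCrossWork k l  ≤⟨ +-monoˡ-≤ (finalCrossWork k l)
                                                         (p≤p+q {charge k l} (charge-nonneg l k)) ⟩
          rhs                              ∎
        ordered _ flow-l (inj₂ Ck≤Cl) = begin
          crossWork k l            ≤⟨ crossWork≤wt*d k l ⟩
          wt l * d k               ≡⟨ charge-flow flow-l Ck≤Cl ⟨
          charge l k               ≤⟨ q≤p+q {charge k l} (charge-nonneg k l) ⟩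
          charge k l + charge l k  ≤⟨ p≤p+q {charge k l + charge l k} (finalCrossWork-nonneg k l) ⟩
          rhs                      ∎
        cases : Dec (T (hasFlow k)) → Dec (T (hasFlow l)) → crossWork k l ≤ rhs
        cases (yes flow-k) (yes flow-l) = ordered flow-k flow-l (ℕₚ.≤-total (C l) (C k))
        cases (no ¬flow-k) _            = ≤-trans (≤-reflexive (crossWork-without-flow (inj₁ ¬flow-k))) rhs-nonneg
        cases _            (no ¬flow-l) = ≤-trans (≤-reflexive (crossWork-without-flow (inj₂ ¬flow-l))) rhs-nonneg

      ∑charge≤ : ∀ k → sum (charge k) ≤ (φ k * wt k) * ℕ→ℚ (C k)
      ∑charge≤ k = begin
        sum (charge k)
          ≡⟨ sum-cong-≗ (λ l → rearrange (φ k) (ind ⌊ C l ℕ.≤? C k ⌋) (wt k) (d l)) ⟩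
        sum (λ l → (φ k * wt k) * (ind ⌊ C l ℕ.≤? C k ⌋ * d l))
          ≡⟨ *-distribˡ-sum (φ k * wt k) (λ l → ind ⌊ C l ℕ.≤? C k ⌋ * d l) ⟨
        (φ k * wt k) * sum (λ l → ind ⌊ C l ℕ.≤? C k ⌋ * d l)
          ≤⟨ *-monoˡ-≤-nonneg (*-nonneg (φ-nonneg k) (wt-nonneg k)) (∑earlier-d≤completion k) ⟩
        (φ k * wt k) * ℕ→ℚ (C k)
          ∎
        where
        open ≤-Reasoning
        rearrange : ∀ a b c e → a * (b * (c * e)) ≡ (a * c) * (b * e)
        rearrange = solve 4 (λ a b c e → a :* (b :* (c :* e)) := (a :* c) :* (b :* e)) refl
          where open ℚ-Solver

      ∑finalCrossWork≤ : ∀ l → sum (λ k → finalCrossWork k l) ≤ φ l * wt l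
      ∑finalCrossWork≤ l = begin
        sum (λ k → finalCrossWork k l)                 ≤⟨ sum-mono-≤ (λ k → Σ<-mono-≤ N (cross k)) ⟩
        sum (λ k → Σ< N (λ s → μ s * (wt l * ρ k s)))  ≡⟨ Σ<-comm-sum N (λ k s → μ s * (wt l * ρ k s)) ⟩
        Σ< N (λ s → sum (λ k → μ s * (wt l * ρ k s)))  ≤⟨ Σ<-mono-≤ N slot ⟩
        Σ< N (λ s → μ s * wt l)                        ≡⟨ *-distribʳ-Σ< N (wt l) μ ⟨
        Σ< N μ * wt l                                  ≤⟨ *-monoʳ-≤-nonneg (wt-nonneg l) (Σ<finishing≤φ N l) ⟩
        φ l * wt l                                     ∎
        where
        open ≤-Reasoning
        μ : ℕ → ℚ
        μ s = ind (finishing l s)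
        μ-nonneg : ∀ s → 0ℚ ≤ μ s
        μ-nonneg s = ind-nonneg (finishing l s)
        swap : ∀ a b c → a * (b * c) ≡ b * (a * c)
        swap = solve 3 (λ a b c → a :* (b :* c) := b :* (a :* c)) refl
          where open ℚ-Solver
        cross : ∀ k s → (wt k * ind (busy k s)) * (μ s * ρ l s) ≤ μ s * (wt l * ρ k s)
        cross k s = begin
          (wt k * ind (busy k s)) * (μ s * ρ l s)  ≡⟨ swap (wt k * ind (busy k s)) (μ s) (ρ l s) ⟩
          μ s * ((wt k * ind (busy k s)) * ρ l s)  ≤⟨ *-monoˡ-≤-nonneg (μ-nonneg s) (ρ-cross s k l busy⇒alive) ⟩
          μ s * (wt l * (ind (busy k s) * ρ k s))  ≤⟨ *-monoˡ-≤-nonneg (μ-nonneg s) (*-monoˡ-≤-nonneg (wt-nonneg l)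
                                                        (*-≤ˡ (ρ-nonneg k s) (ind-≤1 (busy k s)))) ⟩
          μ s * (wt l * ρ k s)                     ∎
        slot : ∀ s → sum (λ k → μ s * (wt l * ρ k s)) ≤ μ s * wt l
        slot s = begin
          sum (λ k → μ s * (wt l * ρ k s))  ≡⟨ sum-cong-≗ (λ k → *-assoc (μ s) (wt l) (ρ k s)) ⟨
          sum (λ k → (μ s * wt l) * ρ k s)  ≡⟨ *-distribˡ-sum (μ s * wt l) (λ k → ρ k s) ⟨
          (μ s * wt l) * sum (λ k → ρ k s)  ≤⟨ *-monoˡ-≤-nonneg (*-nonneg (μ-nonneg s) (wt-nonneg l))
                                                                (∑ρ≤1 s) ⟩
          (μ s * wt l) * 1ℚ                 ≡⟨ *-identityʳ (μ s * wt l) ⟩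
          μ s * wt l                        ∎

      ∑wt*busyTime≤3*localCost : sum (λ k → wt k * busyTime k N) ≤ (localCost + localCost) + localCost
      ∑wt*busyTime≤3*localCost = begin
        sum (λ k → wt k * busyTime k N)
          ≡⟨ sum-cong-≗ wt*busyTime≡∑crossWork ⟩
        sum (λ k → sum (crossWork k))
          ≤⟨ sum-mono-≤ (λ k → sum-mono-≤ (crossWork≤charges k)) ⟩
        sum (λ k → sum (λ l → (charge k l + charge l k) + finalCrossWork k l))
          ≡⟨ ∑∑-symmetrise charge finalCrossWork ⟩
        (sum (λ k → sum (charge k)) + sum (λ k → sum (charge k))) + sum (λ l → sum (λ k → finalCrossWork k l))
          ≤⟨ +-mono-≤ (+-mono-≤ (sum-mono-≤ ∑charge≤) (sum-mono-≤ ∑charge≤))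
                      (≤-trans (sum-mono-≤ ∑finalCrossWork≤) ∑φ*wt≤localCost) ⟩
        (localCost + localCost) + localCost
          ∎
        where open ≤-Reasoning

      port-bound : sum (λ k → wt k * (φ k * completionBound N k)) ≤ ℕ→ℚ 4 * localCost
      port-bound = begin
        sum (λ k → wt k * (φ k * completionBound N k))
          ≡⟨ sum-cong-≗ (λ k → trans (cong (wt k *_) (*-distribˡ-+ (φ k) _ _)) (*-distribˡ-+ (wt k) _ _)) ⟩
        sum (λ k → release-term k + busy-term k)
          ≡⟨ ∑-distrib-+ release-term busy-term ⟩
        sum release-term + sum busy-term
          ≤⟨ +-mono-≤ (sum-mono-≤ release-term≤) (≤-trans (sum-mono-≤ busy-term≤) ∑wt*busyTime≤3*localCost) ⟩
        localCost + ((localCost + localCost) + localCost)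
          ≡⟨ four localCost ⟩
        ℕ→ℚ 4 * localCost
          ∎
        where
        open ≤-Reasoning
        open ℚ-Solver using (solve; _:*_; _:+_; _:=_; con)
        release-term busy-term : Fin n → ℚ
        release-term k = wt k * (φ k * (ℕ→ℚ (rel k) + 1ℚ))
        busy-term    k = wt k * (φ k * busyTime k N)
        release-term≤ : ∀ k → release-term k ≤ (φ k * wt k) * ℕ→ℚ (C k)
        release-term≤ k = begin
          wt k * (φ k * (ℕ→ℚ (rel k) + 1ℚ))  ≤⟨ *-monoˡ-≤-nonneg (wt-nonneg k) (φ*[release+1]≤φ*C k) ⟩
          wt k * (φ k * ℕ→ℚ (C k))           ≡⟨ solve 3 (λ a b c → a :* (b :* c) := (b :* a) :* c) refl
                                                        (wt k) (φ k) (ℕ→ℚ (C k)) ⟩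
          (φ k * wt k) * ℕ→ℚ (C k)           ∎
        busy-term≤ : ∀ k → busy-term k ≤ wt k * busyTime k N
        busy-term≤ k = *-monoˡ-≤-nonneg (wt-nonneg k) (*-≤ˡ (busyTime-nonneg k N) (ind-≤1 (hasFlow k)))
        four : ∀ z → z + ((z + z) + z) ≡ ℕ→ℚ 4 * z
        four = solve 1 (λ z → z :+ ((z :+ z) :+ z) := con (ℕ→ℚ 4) :* z) refl

-- The concurrent open shop

module OpenShop {m n : ℕ} (I : Instance m n) (wf : WellFormed I) where
  open Instance I
  open Conc I
  open Indicator I
  module P = Port I wf

  wt-nonneg : ∀ k → 0ℚ ≤ wt k
  wt-nonneg k = <⇒≤ (proj₂ wf k)

  conc-diag : ∀ k i t → concSchedule I k i i t ≡ rate k i t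
  conc-diag k i t with i Finₚ.≟ i
  ... | yes _   = refl
  ... | no  i≢i = contradiction refl i≢i

  conc-offdiag : ∀ k {i j} t → i ≢ j → concSchedule I k i j t ≡ 0ℚ
  conc-offdiag k {i} {j} t i≢j with i Finₚ.≟ j
  ... | yes i≡j = contradiction i≡j i≢j
  ... | no  _   = refl

  conc-nonneg : ∀ k i j t → 0ℚ ≤ concSchedule I k i j t
  conc-nonneg k i j t with i Finₚ.≟ j
  ... | yes refl = P.ρ-nonneg i k t
  ... | no  _    = ≤-refl

  conc-before-release : ∀ k i j t → t ℕ.< rel k → concSchedule I k i j t ≡ 0ℚ
  conc-before-release k i j t t<r with i Finₚ.≟ j
  ... | yes refl = P.ρ-dead i (λ alive → ℕₚ.<⇒≱ t<r (proj₁ (P.alive-elim i alive)))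
  ... | no  _    = refl

  diag-load : ∀ i t → ΣF (λ k → concSchedule I k i i t) ≡ sum (λ k → rate k i t)
  diag-load i t = trans (ΣF≡sum (λ k → concSchedule I k i i t)) (sum-cong-≗ (λ k → conc-diag k i t))

  offdiag-load : ∀ {i j} t → i ≢ j → ΣF (λ k → concSchedule I k i j t) ≡ 0ℚ
  offdiag-load {i} {j} t i≢j =
    trans (ΣF≡sum (λ k → concSchedule I k i j t))
          (trans (sum-cong-≗ (λ k → conc-offdiag k t i≢j)) (sum-replicate-zero n))

  diagonal-load≤1 : ∀ i t (f : Fin m → ℚ) → (∀ j → j ≢ i → f j ≡ 0ℚ) →
                    f i ≡ ΣF (λ k → concSchedule I k i i t) → ΣF f ≤ 1ℚ
  diagonal-load≤1 i t f off-diagonal≡0 diagonal = begin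
    ΣF f                               ≡⟨ ΣF≡sum f ⟩
    sum f                              ≡⟨ sum-single i off-diagonal≡0 ⟩
    f i                                ≡⟨ diagonal ⟩
    ΣF (λ k → concSchedule I k i i t)  ≡⟨ diag-load i t ⟩
    sum (λ k → rate k i t)             ≤⟨ P.∑ρ≤1 i t ⟩
    1ℚ                                 ∎
    where open ≤-Reasoning

  input-capacity : ∀ i t → ΣF (λ j → ΣF (λ k → concSchedule I k i j t)) ≤ 1ℚ
  input-capacity i t = diagonal-load≤1 i t _ (λ j j≢i → offdiag-load t (j≢i ∘ sym)) refl

  output-capacity : ∀ j t → ΣF (λ i → ΣF (λ k → concSchedule I k i j t)) ≤ 1ℚ
  output-capacity j t = diagonal-load≤1 j t _ (λ i i≢j → offdiag-load t i≢j) refl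

  feasible : Feasible I (concSchedule I)
  feasible = conc-nonneg , conc-before-release , input-capacity , output-capacity

  finishedBy-intro : ∀ k t → (∀ i → dem k i ≤ cum t k i) → FinishedBy I (concSchedule I) k t
  finishedBy-intro k t done i j with i Finₚ.≟ j
  ... | yes refl = subst (dem k i ≤_) (P.cum≡Σ<ρ i t k) (done i)
  ... | no  _    = Σ<-nonneg t (λ _ → ≤-refl)

  finishedBy? : ∀ k t → Dec (FinishedBy I (concSchedule I) k t)
  finishedBy? k t = Finₚ.all? (λ i → Finₚ.all? (λ j → demand I k i j ≤? sent (concSchedule I) k i j t))

  -- After its release an unfinished flow keeps its port busy, and a port is busy for at most
  -- its total demand plus one overshooting slot per flow.
  totalWork : ℚ
  totalWork = sum (λ i → sum (λ l → dem l i + 1ℚ))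

  horizon : ℕ
  horizon = maxF rel ℕ.+ proj₁ (ℕ→ℚ-archimedean totalWork)

  finished-at-horizon : ∀ k i → dem k i ≤ cum horizon k i
  finished-at-horizon k i = ≮⇒≥ λ unfinished → <⇒≱ (proj₂ (ℕ→ℚ-archimedean totalWork)) (begin
    ℕ→ℚ M                           ≤⟨ ℕ→ℚ-mono-≤ M≤horizon∸rel ⟩
    ℕ→ℚ (horizon ℕ.∸ rel k)         ≤⟨ P.elapsed≤∑[d+1] i horizon k unfinished rel≤horizon ⟩
    sum (λ l → dem l i + 1ℚ)        ≤⟨ ≤-sum (λ i′ → sum-nonneg (λ l → +-nonneg (proj₁ wf l i′) 0≤1))
                                             i ⟩
    totalWork                       ∎)
    where
    open ≤-Reasoning
    M : ℕ
    M = proj₁ (ℕ→ℚ-archimedean totalWork)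
    rel≤horizon : rel k ℕ.≤ horizon
    rel≤horizon = ℕₚ.≤-trans (≤-maxF rel k) (ℕₚ.m≤m+n (maxF rel) M)
    M≤horizon∸rel : M ℕ.≤ horizon ℕ.∸ rel k
    M≤horizon∸rel = subst (ℕ._≤ horizon ℕ.∸ rel k) (ℕₚ.m+n∸m≡n (maxF rel) M)
                          (ℕₚ.∸-monoʳ-≤ horizon (≤-maxF rel k))

  completion : ∀ k → Σ ℕ (IsCompletionTime I (concSchedule I) k)
  completion k =
    first-occurrence (finishedBy? k) {horizon} (finishedBy-intro k horizon (finished-at-horizon k))

  Tc : Fin n → ℕ
  Tc k = proj₁ (completion k)

  Tc-isCompletionTime : ∀ k → IsCompletionTime I (concSchedule I) k (Tc k)
  Tc-isCompletionTime k = proj₂ (completion k)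

  Tc≤horizon : ∀ k → Tc k ℕ.≤ horizon
  Tc≤horizon k = ℕₚ.≮⇒≥ λ horizon<Tc →
    proj₂ (Tc-isCompletionTime k) horizon horizon<Tc (finishedBy-intro k horizon (finished-at-horizon k))

  Tc≤∑completionBound : ∀ k → ℕ→ℚ (Tc k) ≤ sum (λ i → P.φ i k * P.completionBound i horizon k)
  Tc≤∑completionBound k = bound (Tc k) refl
    where
    bound-nonneg : ∀ i → 0ℚ ≤ P.φ i k * P.completionBound i horizon k
    bound-nonneg i = P.φ*completionBound-nonneg i horizon k
    bound : ∀ c → Tc k ≡ c → ℕ→ℚ c ≤ sum (λ i → P.φ i k * P.completionBound i horizon k)
    bound zero    _      = sum-nonneg bound-nonneg
    bound (suc t) Tc≡1+t = ≤-trans (P.unfinished⇒≤completionBound i k t≤horizon (≰⇒> (proj₂ unfinished-port)))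
                                   (≤-sum bound-nonneg i)
      where
      not-done : ¬ (∀ i → dem k i ≤ cum t k i)
      not-done done = proj₂ (Tc-isCompletionTime k) t (subst (t ℕ.<_) (sym Tc≡1+t) (ℕₚ.n<1+n t))
                            (finishedBy-intro k t done)
      unfinished-port : ∃ λ i → ¬ dem k i ≤ cum t k i
      unfinished-port = Finₚ.¬∀⟶∃¬ m (λ i → dem k i ≤ cum t k i) (λ i → dem k i ≤? cum t k i) not-done
      i : Fin m
      i = proj₁ unfinished-port
      t≤horizon : t ℕ.≤ horizon
      t≤horizon = ℕₚ.<⇒≤ (subst (ℕ._≤ horizon) Tc≡1+t (Tc≤horizon k))

  ∑φ≤pmax : ∀ k → sum (λ i → P.φ i k) ≤ ℕ→ℚ (pmax I)
  ∑φ≤pmax k = begin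
    sum (λ i → P.φ i k)
      ≡⟨ sum-cong-≗ (λ i → cong ind (∨-comm ⌊ 0ℚ <? dem k i ⌋ ⌊ dem k i <? 0ℚ ⌋)) ⟩
    sum (λ i → ind (flow k i))
      ≡⟨ countF≡∑ind (flow k) ⟨
    ℕ→ℚ (countF (flow k))
      ≤⟨ ℕ→ℚ-mono-≤ (≤-maxF (countF ∘ flow) k) ⟩
    ℕ→ℚ (pmax I)
      ∎
    where
    open ≤-Reasoning
    flow : Fin n → Fin m → Bool
    flow l i = ⌊ dem l i <? 0ℚ ⌋ ∨ ⌊ 0ℚ <? dem l i ⌋

  module _ (x : Schedule m n) (x-feasible : Feasible I x)
           (C : Fin n → ℕ) (x-completion : ∀ k → IsCompletionTime I x k (C k)) where

    module A (i : Fin m) = P.Against i x x-feasible C (proj₁ ∘ x-completion)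

    ∑localCost≤ : sum A.localCost ≤ ℕ→ℚ (pmax I) * cost I C
    ∑localCost≤ = begin
      sum (λ i → sum (λ k → (P.φ i k * wt k) * ℕ→ℚ (C k)))
        ≡⟨ ∑-comm (λ i k → (P.φ i k * wt k) * ℕ→ℚ (C k)) ⟩
      sum (λ k → sum (λ i → (P.φ i k * wt k) * ℕ→ℚ (C k)))
        ≡⟨ sum-cong-≗ (λ k → trans (sum-cong-≗ (λ i → *-assoc (P.φ i k) (wt k) (ℕ→ℚ (C k))))
                                   (sym (*-distribʳ-sum (wt k * ℕ→ℚ (C k)) (λ i → P.φ i k)))) ⟩
      sum (λ k → sum (λ i → P.φ i k) * (wt k * ℕ→ℚ (C k)))
        ≤⟨ sum-mono-≤ (λ k → *-monoʳ-≤-nonneg (*-nonneg (wt-nonneg k) (ℕ→ℚ-nonneg (C k))) (∑φ≤pmax k)) ⟩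
      sum (λ k → ℕ→ℚ (pmax I) * (wt k * ℕ→ℚ (C k)))
        ≡⟨ *-distribˡ-sum (ℕ→ℚ (pmax I)) (λ k → wt k * ℕ→ℚ (C k)) ⟨
      ℕ→ℚ (pmax I) * sum (λ k → wt k * ℕ→ℚ (C k))
        ≡⟨ cong (ℕ→ℚ (pmax I) *_) (ΣF≡sum (λ k → wt k * ℕ→ℚ (C k))) ⟨
      ℕ→ℚ (pmax I) * cost I C
        ∎
      where open ≤-Reasoning

    cost-bound : cost I Tc ≤ ℕ→ℚ (4 ℕ.* pmax I) * cost I C
    cost-bound = begin
      cost I Tc
        ≡⟨ ΣF≡sum (λ k → wt k * ℕ→ℚ (Tc k)) ⟩
      sum (λ k → wt k * ℕ→ℚ (Tc k))
        ≤⟨ sum-mono-≤ (λ k → *-monoˡ-≤-nonneg (wt-nonneg k) (Tc≤∑completionBound k)) ⟩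
      sum (λ k → wt k * sum (λ i → P.φ i k * B i k))
        ≡⟨ sum-cong-≗ (λ k → *-distribˡ-sum (wt k) (λ i → P.φ i k * B i k)) ⟩
      sum (λ k → sum (λ i → wt k * (P.φ i k * B i k)))
        ≡⟨ ∑-comm (λ k i → wt k * (P.φ i k * B i k)) ⟩
      sum (λ i → sum (λ k → wt k * (P.φ i k * B i k)))
        ≤⟨ sum-mono-≤ (λ i → A.port-bound i horizon) ⟩
      sum (λ i → ℕ→ℚ 4 * A.localCost i)
        ≡⟨ *-distribˡ-sum (ℕ→ℚ 4) A.localCost ⟨
      ℕ→ℚ 4 * sum A.localCost
        ≤⟨ *-monoˡ-≤-nonneg (ℕ→ℚ-nonneg 4) ∑localCost≤ ⟩
      ℕ→ℚ 4 * (ℕ→ℚ (pmax I) * cost I C)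
        ≡⟨ *-assoc (ℕ→ℚ 4) (ℕ→ℚ (pmax I)) (cost I C) ⟨
      (ℕ→ℚ 4 * ℕ→ℚ (pmax I)) * cost I C
        ≡⟨ cong (_* cost I C) (ℕ→ℚ-* 4 (pmax I)) ⟨
      ℕ→ℚ (4 ℕ.* pmax I) * cost I C
        ∎
      where
      open ≤-Reasoning
      B : Fin m → Fin n → ℚ
      B i = P.completionBound i horizon

corollary1 : ∀ {m n : ℕ} (I : Instance m n) → WellFormed I →
    Feasible I (concSchedule I) ×
    Σ (Fin n → ℕ) (λ Tc →
      (∀ k → IsCompletionTime I (concSchedule I) k (Tc k)) ×
      (∀ (x : Schedule m n) → Feasible I x →
        ∀ (T : Fin n → ℕ) → (∀ k → IsCompletionTime I x k (T k)) →
        cost I Tc ≤ ℕ→ℚ (4 Data.Nat.* pmax I) * cost I T))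
corollary1 I wf = feasible , Tc , Tc-isCompletionTime , cost-bound
  where open OpenShop I wf
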